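{- Every cuboid of size $1\times r_2\times r_3$ satisfying condition $(\ast)$, with $r_2,r_3\ge3$ and the side of length $r_2$ very proper, has a very proper decomposition.
   Context: Fix integers $n_1,\dots,n_s\ge2$, let $Q_n$ be the Boolean lattice of subsets of $[n]$, and $P=Q_{n_1}\times\cdots\times Q_{n_s}$ with product order and rank $\sum|a_i|$. For a nonempty $I\subseteq\{1,\dots,s\}$ let $P_I=\prod_{i\in I}Q_{n_i}$. A chain in $P_I$ skips no ranks if its ranks form an integer interval; its length is its number of elements. A chain $C$ in $P_I$ skipping no ranks is very proper if for all distinct $a,a'\in C$ there is $i\in I$ with $a_i\ne a'_i$ and $\{a_i,a'_i\}\ne\{\varnothing,[n_i]\}$; it is proper if this holds for all pairs of distinct elements except possibly the pair formed by the minimum and maximum of $P_I$. A cuboid is $C_1\times\cdots\times C_t\subseteq P$, where $I_1,\dots,I_t$ partition $\{1,\dots,s\}$ and each side $C_j$ is a chain in $P_{I_j}$ skipping no ranks; its size is $|C_1|\times\cdots\times|C_t|$ (sides in any order). It is graded with rank of $(c_1,\dots,c_t)$ equal to $\sum_j(\text{position of }c_j\text{ in }C_j\text{ from }0)$ and top rank $N=\sum_j(|C_j|-1)$; a chain in it is symmetric if it has exactly one element of each rank $j,\dots,N-j$ for some $j$. A very proper decomposition of the cuboid is a partition of it into symmetric chains each of which is a very proper chain in $P$. Condition $(\ast)$: every side is a proper chain in its $P_{I_j}$, and every side of length $<5$ is very proper. -}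

module Defs where

open import Data.Nat using (ℕ; zero; suc; _+_; _*_; _∸_; _≤_; _<_)
open import Data.Fin using (Fin; toℕ; _≟_) renaming (zero to 0F; suc to sF)
open import Data.Fin.Subset using (Subset; _⊆_; ∣_∣) renaming (⊥ to ∅; ⊤ to full)
open import Data.Bool using (Bool; true; false; if_then_else_)
open import Data.List using (List; []; _∷_; length; map; lookup; concat; applyUpTo)
open import Data.List.Membership.Propositional using (_∈_)
open import Data.List.Relation.Unary.Linked using (Linked)
open import Data.List.Relation.Unary.All using (All)
open import Data.List.Relation.Unary.Unique.Propositional using (Unique)
open import Data.Product using (_×_; _,_; ∃-syntax)
open import Data.Sum using (_⊎_)
open import Relation.Nullary using (¬_)
open import Relation.Nullary.Decidable using (⌊_⌋)
open import Relation.Binary.PropositionalEquality using (_≡_; _≢_)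

Σℕ : (k : ℕ) → (Fin k → ℕ) → ℕ
Σℕ zero f = 0
Σℕ (suc k) f = f 0F + Σℕ k (λ i → f (sF i))

Idx : ℕ → Set
Idx s = Fin s → Bool

allIdx : {s : ℕ} → Idx s
allIdx _ = true

module _ {s : ℕ} (n : Fin s → ℕ) where

  -- Elements of P = Q_{n_1} × ... × Q_{n_s}.  An element of P_I is represented
  -- by an element of P whose coordinates outside I are ignored.
  Elt : Set
  Elt = (i : Fin s) → Subset (n i)

  _≤[_]_ : Elt → Idx s → Elt → Set
  a ≤[ I ] b = ∀ i → I i ≡ true → a i ⊆ b i

  EqOn : Idx s → Elt → Elt → Set
  EqOn I a b = ∀ i → I i ≡ true → a i ≡ b i

  _<[_]_ : Elt → Idx s → Elt → Set
  a <[ I ] b = (a ≤[ I ] b) × ¬ EqOn I a b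

  rank : Idx s → Elt → ℕ
  rank I a = Σℕ s (λ i → if I i then ∣ a i ∣ else 0)

  IsChain : Idx s → List Elt → Set
  IsChain I xs = Linked (λ a b → a <[ I ] b) xs

  SkipsNoRanks : Idx s → List Elt → Set
  SkipsNoRanks I xs = ∀ {a b} → a ∈ xs → b ∈ xs → ∀ k →
    rank I a ≤ k → k ≤ rank I b → ∃[ c ] (c ∈ xs × rank I c ≡ k)

  GoodPair : Idx s → Elt → Elt → Set
  GoodPair I a a' = ∃[ i ] (I i ≡ true × a i ≢ a' i ×
    ¬ ((a i ≡ ∅ × a' i ≡ full) ⊎ (a i ≡ full × a' i ≡ ∅)))

  IsMin IsMax : Idx s → Elt → Set
  IsMin I a = ∀ i → I i ≡ true → a i ≡ ∅
  IsMax I a = ∀ i → I i ≡ true → a i ≡ full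

  MinMaxPair : Idx s → Elt → Elt → Set
  MinMaxPair I a a' = (IsMin I a × IsMax I a') ⊎ (IsMax I a × IsMin I a')

  VeryProper : Idx s → List Elt → Set
  VeryProper I xs = IsChain I xs × SkipsNoRanks I xs ×
    (∀ {a a'} → a ∈ xs → a' ∈ xs → ¬ EqOn I a a' → GoodPair I a a')

  Proper : Idx s → List Elt → Set
  Proper I xs = IsChain I xs × SkipsNoRanks I xs ×
    (∀ {a a'} → a ∈ xs → a' ∈ xs → ¬ EqOn I a a' → ¬ MinMaxPair I a a' → GoodPair I a a')

  -- Cuboids with three sides C_0 × C_1 × C_2.  The partition
  -- I_0, I_1, I_2 of {1..s} is given by blk : Fin s → Fin 3
  -- (I_j = blk⁻¹(j)); side C j is a chain in P_{I_j}.

  block : (Fin s → Fin 3) → Fin 3 → Idx s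
  block blk j i = ⌊ blk i ≟ j ⌋

  module Cuboid (blk : Fin s → Fin 3) (C : Fin 3 → List Elt) where

    Pos : Set
    Pos = Fin (length (C 0F)) × Fin (length (C (sF 0F))) × Fin (length (C (sF (sF 0F))))

    coord : (j : Fin 3) → Pos → Fin (length (C j))
    coord 0F (p , _ , _) = p
    coord (sF 0F) (_ , p , _) = p
    coord (sF (sF 0F)) (_ , _ , p) = p

    elt : Pos → Elt
    elt p i = lookup (C (blk i)) (coord (blk i) p) i

    crank : Pos → ℕ
    crank p = toℕ (coord 0F p) + toℕ (coord (sF 0F) p) + toℕ (coord (sF (sF 0F)) p)

    Ntop : ℕ
    Ntop = (length (C 0F) ∸ 1) + (length (C (sF 0F)) ∸ 1) + (length (C (sF (sF 0F))) ∸ 1)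

    _≤c_ : Pos → Pos → Set
    p ≤c q = ∀ j → toℕ (coord j p) ≤ toℕ (coord j q)

    -- a symmetric chain of the cuboid, listed in increasing order:
    -- exactly one element of each rank j, j+1, ..., N-j
    SymmetricChain : List Pos → Set
    SymmetricChain xs = Linked _≤c_ xs ×
      ∃[ j ] (2 * j ≤ Ntop × map crank xs ≡ applyUpTo (j +_) (suc (Ntop ∸ j ∸ j)))

    HasVeryProperDecomposition : Set
    HasVeryProperDecomposition = ∃[ D ] ((∀ (p : Pos) → p ∈ concat D) × Unique (concat D) ×
      All (λ xs → SymmetricChain xs × VeryProper allIdx (map elt xs)) D)

-- The first side has a single element, so the cuboid is the grid [0,a] × [0,b] with a, b ≥ 2, whose
-- coordinates are the positions in the second and third side. As the sides skip no ranks, a unit step in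
-- the grid raises the rank in P by one, so a lattice path in the grid is a chain of P skipping no ranks.
-- Two of its points in different columns form a good pair because the second side is very proper, and two
-- points in the same column do so because the third side is proper, unless they are the bottom and the top
-- of that column. It therefore suffices to partition the grid into symmetric lattice paths none of which
-- contains both ends of a column. The hooks H_k, going up column k from (k,0) to (k,b−k) and then right to
-- (a,b−k), do this for 2 ≤ k ≤ min(a,b); the hooks H_0 and H_1 are replaced by
--   A : (0,0) → (1,0) → (1,b−1) → (a,b−1) → (a,b)   and   B : (0,1) → (0,b) → (a−1,b).

module Submission where

open import Defs
open import Data.Bool using (Bool; true; false; if_then_else_)
open import Data.Empty using (⊥; ⊥-elim)
open import Data.Fin using (Fin; toℕ; _≟_; cast; fromℕ; fromℕ<) renaming (zero to 0F; suc to sF)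
open import Data.Fin.Properties using (toℕ-injective; toℕ≤pred[n]; toℕ-fromℕ; toℕ-cast; toℕ-fromℕ<)
open import Data.Fin.Subset using (Subset; _⊆_; ∣_∣; inside; outside)
open import Data.Fin.Subset.Properties using (p⊆q⇒∣p∣≤∣q∣; drop-∷-⊆; ⊆-reflexive; ∣p∣≤n; ∣⊥∣≡0; ∣⊤∣≡n)
open import Data.List using (List; []; _∷_; length; lookup; map; applyUpTo; replicate; _++_; concat)
open import Data.List.Properties
  using (map-upTo; map-cong; map-∘; map-cong-local; concat-map; length-++; length-replicate)
open import Data.List.Membership.Propositional using (_∈_)
open import Data.List.Membership.Propositional.Properties
  using (∈-++⁺ˡ; ∈-++⁺ʳ; ∈-concat⁺′; ∈-applyUpTo⁺; ∈-map⁺; ∈-map⁻; ∈-lookup)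
open import Data.List.Relation.Binary.Disjoint.Propositional using (Disjoint)
open import Data.List.Relation.Unary.All using (All; []; _∷_)
import Data.List.Relation.Unary.All as All
import Data.List.Relation.Unary.All.Properties as All
open import Data.List.Relation.Unary.AllPairs using (_∷_)
import Data.List.Relation.Unary.AllPairs as AllPairs
import Data.List.Relation.Unary.AllPairs.Properties as AllPairs
open import Data.List.Relation.Unary.Any using (here; there)
open import Data.List.Relation.Unary.Linked using (Linked; []; [-]; _∷_)
import Data.List.Relation.Unary.Linked as Linked
import Data.List.Relation.Unary.Linked.Properties as Linked
open import Data.List.Relation.Unary.Unique.Propositional using (Unique)
import Data.List.Relation.Unary.Unique.Propositional.Properties as Unique
open import Data.Nat using (ℕ; zero; suc; _+_; _*_; _∸_; _≤_; _<_; z≤n; s≤s; s≤s⁻¹; _⊓_; pred)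
  renaming (_≟_ to _≟ℕ_)
open import Data.Nat.Properties hiding (_≟_)
open import Algebra.Properties.CommutativeSemigroup +-commutativeSemigroup
  using () renaming (interchange to +-interchange)
open import Data.Nat.Tactic.RingSolver using (solve-∀)
open import Data.Product using (_×_; _,_; ∃-syntax; proj₁; proj₂)
open import Data.Sum using (_⊎_; inj₁; inj₂)
open import Data.Unit using (⊤; tt)
open import Data.Vec using ([]; _∷_; here)
open import Function using (_∘_; _on_)
open import Relation.Binary.PropositionalEquality
open import Relation.Nullary using (¬_; yes; no)

pattern 1F = sF 0F
pattern 2F = sF (sF 0F)

Σℕ-cong : ∀ k {f g : Fin k → ℕ} → (∀ i → f i ≡ g i) → Σℕ k f ≡ Σℕ k g
Σℕ-cong zero f≡g = refl
Σℕ-cong (suc k) f≡g = cong₂ _+_ (f≡g 0F) (Σℕ-cong k (f≡g ∘ sF))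

Σℕ-+ : ∀ k (f g : Fin k → ℕ) → Σℕ k (λ i → f i + g i) ≡ Σℕ k f + Σℕ k g
Σℕ-+ zero f g = refl
Σℕ-+ (suc k) f g =
  trans (cong (f 0F + g 0F +_) (Σℕ-+ k (f ∘ sF) (g ∘ sF))) (+-interchange (f 0F) (g 0F) _ _)

Σℕ-mono-≤ : ∀ k {f g : Fin k → ℕ} → (∀ i → f i ≤ g i) → Σℕ k f ≤ Σℕ k g
Σℕ-mono-≤ zero f≤g = z≤n
Σℕ-mono-≤ (suc k) f≤g = +-mono-≤ (f≤g 0F) (Σℕ-mono-≤ k (f≤g ∘ sF))

Σℕ-zero : ∀ k → Σℕ k (λ _ → 0) ≡ 0
Σℕ-zero zero = refl
Σℕ-zero (suc k) = Σℕ-zero k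

Σℕ-≤-≡⇒≡ : ∀ k {f g : Fin k → ℕ} → (∀ i → f i ≤ g i) → Σℕ k f ≡ Σℕ k g → ∀ i → f i ≡ g i
Σℕ-≤-≡⇒≡ (suc k) {f} {g} f≤g Σf≡Σg = λ where
    0F     → f₀≡g₀
    (sF i) → Σℕ-≤-≡⇒≡ k (f≤g ∘ sF) (+-cancelˡ-≡ (f 0F) _ _ (trans Σf≡Σg (cong (_+ _) (sym f₀≡g₀)))) i
  where
  f₀≡g₀ : f 0F ≡ g 0F
  f₀≡g₀ = ≤-antisym (f≤g 0F) (+-cancelʳ-≤ _ (g 0F) (f 0F)
    (≤-trans (+-monoʳ-≤ (g 0F) (Σℕ-mono-≤ k (f≤g ∘ sF))) (≤-reflexive (sym Σf≡Σg))))

⊆∧∣≡∣⇒≡ : ∀ {m} {p q : Subset m} → p ⊆ q → ∣ p ∣ ≡ ∣ q ∣ → p ≡ q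
⊆∧∣≡∣⇒≡ {p = []} {[]} _ _ = refl
⊆∧∣≡∣⇒≡ {p = outside ∷ p} {outside ∷ q} p⊆q eq = cong (outside ∷_) (⊆∧∣≡∣⇒≡ (drop-∷-⊆ p⊆q) eq)
⊆∧∣≡∣⇒≡ {p = inside ∷ p} {inside ∷ q} p⊆q eq = cong (inside ∷_) (⊆∧∣≡∣⇒≡ (drop-∷-⊆ p⊆q) (suc-injective eq))
⊆∧∣≡∣⇒≡ {p = inside ∷ p} {outside ∷ q} p⊆q eq with p⊆q here
... | ()
⊆∧∣≡∣⇒≡ {p = outside ∷ p} {inside ∷ q} p⊆q eq = ⊥-elim (<-irrefl eq (s≤s (p⊆q⇒∣p∣≤∣q∣ (drop-∷-⊆ p⊆q))))

-- Ranks in P_I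

if-lift : ∀ {c : Bool} {x y : ℕ} (R : ℕ → ℕ → Set) → R 0 0 → (c ≡ true → R x y) →
          R (if c then x else 0) (if c then y else 0)
if-lift {true}  R _   r = r refl
if-lift {false} R r₀ _ = r₀

if-true-injective : ∀ {c : Bool} {x y : ℕ} → c ≡ true → (if c then x else 0) ≡ (if c then y else 0) → x ≡ y
if-true-injective refl eq = eq

module _ {s : ℕ} (n : Fin s → ℕ) where

  rankTop : Idx s → ℕ
  rankTop I = Σℕ s (λ i → if I i then n i else 0)

  rank-cong : ∀ I {a b} → EqOn n I a b → rank n I a ≡ rank n I b
  rank-cong I a≡b = Σℕ-cong s (λ i → if-lift _≡_ refl (cong ∣_∣ ∘ a≡b i))

  rank-mono : ∀ I {a b} → _≤[_]_ n a I b → rank n I a ≤ rank n I b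
  rank-mono I a≤b = Σℕ-mono-≤ s (λ i → if-lift _≤_ z≤n (p⊆q⇒∣p∣≤∣q∣ ∘ a≤b i))

  rank-strictMono : ∀ I {a b} → _<[_]_ n a I b → rank n I a < rank n I b
  rank-strictMono I {a} {b} (a≤b , a≢b) = ≤∧≢⇒< (rank-mono I a≤b) λ ranks≡ →
    a≢b λ i Ii → ⊆∧∣≡∣⇒≡ (a≤b i Ii) (if-true-injective Ii
      (Σℕ-≤-≡⇒≡ s (λ j → if-lift _≤_ z≤n (p⊆q⇒∣p∣≤∣q∣ ∘ a≤b j)) ranks≡ i))

  rank-min : ∀ I {a} → IsMin n I a → rank n I a ≡ 0
  rank-min I a-min = trans (Σℕ-cong s (λ i → if-lift {y = 0} (λ x _ → x ≡ 0) refl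
    (λ Ii → trans (cong ∣_∣ (a-min i Ii)) (∣⊥∣≡0 (n i))))) (Σℕ-zero s)

  rank-max : ∀ I {a} → IsMax n I a → rank n I a ≡ rankTop I
  rank-max I a-max = Σℕ-cong s (λ i → if-lift _≡_ refl (λ Ii → trans (cong ∣_∣ (a-max i Ii)) (∣⊤∣≡n (n i))))

  rank≤rankTop : ∀ I a → rank n I a ≤ rankTop I
  rank≤rankTop I a = Σℕ-mono-≤ s (λ i → if-lift _≤_ z≤n (λ _ → ∣p∣≤n (a i)))

-- Lists whose values skip no integers

applyUpTo-cong : ∀ {A : Set} {f g : ℕ → A} → (∀ i → f i ≡ g i) → ∀ {n} → applyUpTo f n ≡ applyUpTo g n
applyUpTo-cong {f = f} {g} f≗g {n} = trans (sym (map-upTo f n)) (trans (map-cong f≗g _) (map-upTo g n))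

module _ {A : Set} (f : A → ℕ) where

  SkipsNoValues : List A → Set
  SkipsNoValues xs = ∀ {a b} → a ∈ xs → b ∈ xs → ∀ k → f a ≤ k → k ≤ f b → ∃[ c ] (c ∈ xs × f c ≡ k)

  UnitStep : A → A → Set
  UnitStep u v = f v ≡ suc (f u)

  head-below : ∀ {v ys w} → Linked (_<_ on f) (v ∷ ys) → w ∈ ys → f v < f w
  head-below (v<y ∷ l) w∈ = All.lookup (Linked.Linked⇒All <-trans v<y l) w∈

  head-least : ∀ {v ys w} → Linked (_<_ on f) (v ∷ ys) → w ∈ v ∷ ys → f v ≤ f w
  head-least _ (here refl) = ≤-refl
  head-least l (there w∈)  = <⇒≤ (head-below l w∈)

  skipsNoValues-tail : ∀ {u ys} → Linked (_<_ on f) (u ∷ ys) → SkipsNoValues (u ∷ ys) → SkipsNoValues ys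
  skipsNoValues-tail {u} {ys} l skips a∈ b∈ k a≤k k≤b with skips (there a∈) (there b∈) k a≤k k≤b
  ... | c , there c∈ , fc≡k = c , c∈ , fc≡k
  ... | c , here refl , fu≡k =
    ⊥-elim (<-irrefl fu≡k (<-≤-trans (head-below l a∈) a≤k))

  skipsNoValues⇒unitSteps : ∀ {xs} → Linked (_<_ on f) xs → SkipsNoValues xs → Linked UnitStep xs
  skipsNoValues⇒unitSteps []  _ = []
  skipsNoValues⇒unitSteps [-] _ = [-]
  skipsNoValues⇒unitSteps {u ∷ v ∷ ys} (u<v ∷ l) skips =
    fv≡1+fu ∷ skipsNoValues⇒unitSteps l (skipsNoValues-tail (u<v ∷ l) skips)
    where
    fv≡1+fu : f v ≡ suc (f u)
    fv≡1+fu with skips (here refl) (there (here refl)) (suc (f u)) (n≤1+n (f u)) u<v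
    ... | c , here refl , fu≡1+fu = ⊥-elim (1+n≢n (sym fu≡1+fu))
    ... | c , there c∈ , fc≡1+fu = ≤-antisym (≤-trans (head-least l c∈) (≤-reflexive fc≡1+fu)) u<v

  unitSteps⇒increasing : ∀ {xs} → Linked UnitStep xs → Linked (_<_ on f) xs
  unitSteps⇒increasing = Linked.map (λ fv≡1+fu → ≤-reflexive (sym fv≡1+fu))

  unitSteps-attain : ∀ {x xs b k} → Linked UnitStep (x ∷ xs) → b ∈ x ∷ xs → f x ≤ k → k ≤ f b →
                     ∃[ c ] (c ∈ x ∷ xs × f c ≡ k)
  unitSteps-attain {x} l (here refl) x≤k k≤b = x , here refl , ≤-antisym x≤k k≤b
  unitSteps-attain {x} (fy≡1+fx ∷ l) (there b∈) x≤k k≤b with m≤n⇒m<n∨m≡n x≤k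
  ... | inj₂ fx≡k = x , here refl , fx≡k
  ... | inj₁ x<k with unitSteps-attain l b∈ (≤-trans (≤-reflexive fy≡1+fx) x<k) k≤b
  ...   | c , c∈ , fc≡k = c , there c∈ , fc≡k

  unitSteps⇒skipsNoValues : ∀ {xs} → Linked UnitStep xs → SkipsNoValues xs
  unitSteps⇒skipsNoValues {x ∷ xs} l a∈ b∈ k a≤k k≤b =
    unitSteps-attain l b∈ (≤-trans (head-least (unitSteps⇒increasing l) a∈) a≤k) k≤b

  unitSteps-lookup : ∀ {x xs} → Linked UnitStep (x ∷ xs) → ∀ i → f (lookup (x ∷ xs) i) ≡ f x + toℕ i
  unitSteps-lookup {x} l 0F = sym (+-identityʳ (f x))
  unitSteps-lookup {x} (fy≡1+fx ∷ l) (sF i) =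
    trans (unitSteps-lookup l i) (trans (cong (_+ toℕ i) fy≡1+fx) (sym (+-suc (f x) (toℕ i))))

  unitSteps-map : ∀ {x xs} → Linked UnitStep (x ∷ xs) → map f (x ∷ xs) ≡ applyUpTo (f x +_) (suc (length xs))
  unitSteps-map {x} [-] = cong (_∷ []) (sym (+-identityʳ (f x)))
  unitSteps-map {x} {y ∷ ys} (fy≡1+fx ∷ l) = cong₂ _∷_ (sym (+-identityʳ (f x))) (begin
    map f (y ∷ ys)                               ≡⟨ unitSteps-map l ⟩
    applyUpTo (f y +_) (suc (length ys))         ≡⟨ cong (λ z → applyUpTo (z +_) (suc (length ys))) fy≡1+fx ⟩
    applyUpTo (suc (f x) +_) (suc (length ys))   ≡⟨ applyUpTo-cong (λ i → sym (+-suc (f x) i)) ⟩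
    applyUpTo (λ i → f x + suc i) (suc (length ys)) ∎)
    where open ≡-Reasoning

  increasing⇒unique : ∀ {xs} → Linked (_<_ on f) xs → Unique xs
  increasing⇒unique l =
    AllPairs.map (λ fu<fv u≡v → <-irrefl (cong f u≡v) fu<fv) (Linked.Linked⇒AllPairs <-trans l)

  skipsNoValues-lookup : ∀ {xs} → Linked (_<_ on f) xs → SkipsNoValues xs →
                         ∃[ r ] (∀ i → f (lookup xs i) ≡ r + toℕ i)
  skipsNoValues-lookup {[]}    _ _     = 0 , λ ()
  skipsNoValues-lookup {x ∷ _} l skips = f x , unitSteps-lookup (skipsNoValues⇒unitSteps l skips)

Linked-lookup-suc : ∀ {A : Set} {R : A → A → Set} {xs} → Linked R xs →
                    ∀ i j → toℕ j ≡ suc (toℕ i) → R (lookup xs i) (lookup xs j)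
Linked-lookup-suc (r ∷ _) 0F     (sF 0F) _ = r
Linked-lookup-suc (_ ∷ l) (sF i) (sF j) j≡1+i = Linked-lookup-suc l i j (suc-injective j≡1+i)

-- Lattice paths

Point : Set
Point = ℕ × ℕ

data Move : Set where
  up right : Move

step : Move → Point → Point
step up    (x , y) = x , suc y
step right (x , y) = suc x , y

steps : ℕ → Move → Point → Point
steps zero    m u = u
steps (suc t) m u = steps t m (step m u)

steps-up : ∀ t x y → steps t up (x , y) ≡ (x , y + t)
steps-up zero    x y = cong (x ,_) (sym (+-identityʳ y))
steps-up (suc t) x y = trans (steps-up t x (suc y)) (cong (x ,_) (sym (+-suc y t)))

steps-right : ∀ t x y → steps t right (x , y) ≡ (x + t , y)
steps-right zero    x y = cong (_, y) (sym (+-identityʳ x))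
steps-right (suc t) x y = trans (steps-right t (suc x) y) (cong (_, y) (sym (+-suc x t)))

path : Point → List Move → List Point
path u []       = u ∷ []
path u (m ∷ ms) = u ∷ path (step m u) ms

Step : Point → Point → Set
Step u v = ∃[ m ] (v ≡ step m u)

path-linked : ∀ u ms → Linked Step (path u ms)
path-linked u []           = [-]
path-linked u (m ∷ [])     = (m , refl) ∷ [-]
path-linked u (m ∷ m′ ∷ ms) = (m , refl) ∷ path-linked (step m u) (m′ ∷ ms)

rk : Point → ℕ
rk (x , y) = x + y

rk-step : ∀ {u v} → Step u v → UnitStep rk u v
rk-step {x , y} (up , refl)    = +-suc x y
rk-step {x , y} (right , refl) = refl

steps⇒unique : ∀ {L} → Linked Step L → Unique L
steps⇒unique l = increasing⇒unique rk (unitSteps⇒increasing rk (Linked.map rk-step l))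

start∈path : ∀ u ms → u ∈ path u ms
start∈path u []      = here refl
start∈path u (_ ∷ _) = here refl

∈-path-replicate⁺ : ∀ {t k} m u ms → t ≤ k → steps t m u ∈ path u (replicate k m ++ ms)
∈-path-replicate⁺ {zero}          m u ms _         = start∈path u _
∈-path-replicate⁺ {suc t} {suc k} m u ms (s≤s t≤k) = there (∈-path-replicate⁺ m (step m u) ms t≤k)

∈-path-replicate⁺ʳ : ∀ k m u ms {v} → v ∈ path (steps k m u) ms → v ∈ path u (replicate k m ++ ms)
∈-path-replicate⁺ʳ zero    m u ms v∈ = v∈
∈-path-replicate⁺ʳ (suc k) m u ms v∈ = there (∈-path-replicate⁺ʳ k m (step m u) ms v∈)

∈-path-replicate⁻ : ∀ k m u ms {v} → v ∈ path u (replicate k m ++ ms) →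
                    (∃[ t ] (t ≤ k × v ≡ steps t m u)) ⊎ v ∈ path (steps k m u) ms
∈-path-replicate⁻ zero    m u ms v∈          = inj₂ v∈
∈-path-replicate⁻ (suc k) m u ms (here refl) = inj₁ (0 , z≤n , refl)
∈-path-replicate⁻ (suc k) m u ms (there v∈) with ∈-path-replicate⁻ k m (step m u) ms v∈
... | inj₁ (t , t≤k , refl) = inj₁ (suc t , s≤s t≤k , refl)
... | inj₂ v∈′              = inj₂ v∈′

corner : Point → ℕ → ℕ → List Move → List Point
corner u k l ms = path u (replicate k up ++ replicate l right ++ ms)

∈-corner-up : ∀ {t k} x y l ms → t ≤ k → (x , y + t) ∈ corner (x , y) k l ms
∈-corner-up {t} {k} x y l ms t≤k =
  subst (_∈ corner (x , y) k l ms) (steps-up t x y) (∈-path-replicate⁺ up (x , y) (replicate l right ++ ms) t≤k)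

∈-corner-end : ∀ x y k l ms {v} → v ∈ path (x + l , y + k) ms → v ∈ corner (x , y) k l ms
∈-corner-end x y k l ms {v} v∈ = ∈-path-replicate⁺ʳ k up (x , y) _
  (subst (λ w → v ∈ path w (replicate l right ++ ms)) (sym (steps-up k x y))
    (∈-path-replicate⁺ʳ l right (x , y + k) ms (subst (λ w → v ∈ path w ms) (sym (steps-right l x (y + k))) v∈)))

∈-corner-right : ∀ {t l} x y k ms → t ≤ l → (x + t , y + k) ∈ corner (x , y) k l ms
∈-corner-right {t} {l} x y k ms t≤l = ∈-path-replicate⁺ʳ k up (x , y) _
  (subst (λ w → (x + t , y + k) ∈ path w (replicate l right ++ ms)) (sym (steps-up k x y))
    (subst (_∈ path (x , y + k) (replicate l right ++ ms)) (steps-right t x (y + k))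
      (∈-path-replicate⁺ right (x , y + k) ms t≤l)))

∈-corner⁻ : ∀ x y k l ms {v} → v ∈ corner (x , y) k l ms →
            (∃[ t ] (t ≤ k × v ≡ (x , y + t))) ⊎ (∃[ t ] (t ≤ l × v ≡ (x + t , y + k))) ⊎
            v ∈ path (x + l , y + k) ms
∈-corner⁻ x y k l ms {v} v∈ with ∈-path-replicate⁻ k up (x , y) _ v∈
... | inj₁ (t , t≤k , refl) = inj₁ (t , t≤k , steps-up t x y)
... | inj₂ v∈′ with ∈-path-replicate⁻ l right (x , y + k) ms
                       (subst (λ w → v ∈ path w (replicate l right ++ ms)) (steps-up k x y) v∈′)
...   | inj₁ (t , t≤l , refl) = inj₂ (inj₁ (t , t≤l , steps-right t x (y + k)))
...   | inj₂ v∈″ = inj₂ (inj₂ (subst (λ w → _ ∈ path w ms) (steps-right l x (y + k)) v∈″))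

length-corner : ∀ k l ms → length (replicate k up ++ replicate l right ++ ms) ≡ k + (l + length ms)
length-corner k l ms = trans (length-++ (replicate k up)) (cong₂ _+_ (length-replicate k)
  (trans (length-++ (replicate l right)) (cong (_+ length ms) (length-replicate l))))

length-path : ∀ u ms → length (path u ms) ≡ suc (length ms)
length-path u []       = refl
length-path u (m ∷ ms) = cong suc (length-path (step m u) ms)

path-map-rk : ∀ u ms → map rk (path u ms) ≡ applyUpTo (rk u +_) (suc (length ms))
path-map-rk u []       = unitSteps-map rk {u} {[]} [-]
path-map-rk u (m ∷ ms) = trans (unitSteps-map rk (Linked.map rk-step (path-linked u (m ∷ ms))))
  (cong (λ l → applyUpTo (rk u +_) (suc l)) (length-path (step m u) ms))

symmetric-length : ∀ j l N → j + l + j ≡ N → 2 * j ≤ N × l ≡ N ∸ j ∸ j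
symmetric-length j l N refl = 2j≤ , sym (trans (cong (_∸ j) (m+n∸n≡m (j + l) j)) (m+n∸m≡n j l))
  where
  2j≤ : 2 * j ≤ j + l + j
  2j≤ = ≤-trans (≤-reflexive (cong (j +_) (+-identityʳ j))) (+-monoˡ-≤ j (m≤m+n j l))

∸-swap : ∀ {x y n} → y ≤ n → x ≤ n ∸ y → y ≤ n ∸ x
∸-swap {x} {y} {n} y≤n x≤n∸y = m+n≤o⇒m≤o∸n y (subst (_≤ n) (+-comm x y) (m≤o∸n⇒m+n≤o x y≤n x≤n∸y))

-- A decomposition of the grid [0,a] × [0,b]

module Box (a′ b′ : ℕ) where

  a b : ℕ
  a = 2 + a′
  b = 2 + b′

  InBox : Point → Set
  InBox (x , y) = x ≤ a × y ≤ b

  NoColumnEndPair : List Point → Set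
  NoColumnEndPair L = ∀ {u v} → u ∈ L → v ∈ L → proj₂ u ≡ 0 → proj₂ v ≡ b → proj₁ u ≢ proj₁ v

  SymmetricPath : List Point → Set
  SymmetricPath L = Linked Step L × ∃[ j ] (2 * j ≤ a + b × map rk L ≡ applyUpTo (j +_) (suc (a + b ∸ j ∸ j)))

  GoodChain : List Point → Set
  GoodChain L = SymmetricPath L × All InBox L × NoColumnEndPair L

  path-symmetric : ∀ u ms → rk u + length ms + rk u ≡ a + b → SymmetricPath (path u ms)
  path-symmetric u ms total with symmetric-length (rk u) (length ms) (a + b) total
  ... | 2j≤ , l≡ = path-linked u ms , rk u , 2j≤ ,
    trans (path-map-rk u ms) (cong (λ l → applyUpTo (rk u +_) (suc l)) l≡)

  noColumnEndPair : ∀ {L} (S : ℕ → Set) → (∀ {v} → v ∈ L → proj₂ v ≡ 0 → S (proj₁ v)) →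
                    (∀ {v} → v ∈ L → proj₂ v ≡ b → ¬ S (proj₁ v)) → NoColumnEndPair L
  noColumnEndPair S bottom top u∈ v∈ yu≡0 yv≡b xu≡xv = top v∈ yv≡b (subst S xu≡xv (bottom u∈ yu≡0))

  -- the k such that the point lies on the hook H_k
  hookIndex : Point → ℕ
  hookIndex (x , y) = x ⊓ (b ∸ y)

  chainA : List Point
  chainA = path (0 , 0) (right ∷ replicate (suc b′) up ++ replicate (suc a′) right ++ up ∷ [])

  data OnA : Point → Set where
    origin : OnA (0 , 0)
    rise   : ∀ {t} → t ≤ suc b′ → OnA (1 , t)
    run    : ∀ {t} → t ≤ suc a′ → OnA (suc t , suc b′)
    apex   : OnA (a , b)

  chainA-points : ∀ {v} → v ∈ chainA → OnA v
  chainA-points (here refl) = origin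
  chainA-points (there v∈) with ∈-corner⁻ 1 0 (suc b′) (suc a′) (up ∷ []) v∈
  ... | inj₁ (t , t≤ , refl)          = rise t≤
  ... | inj₂ (inj₁ (t , t≤ , refl))   = run t≤
  ... | inj₂ (inj₂ (here refl))        = run ≤-refl
  ... | inj₂ (inj₂ (there (here refl))) = apex

  OnA⇒∈chainA : ∀ {v} → OnA v → v ∈ chainA
  OnA⇒∈chainA origin     = here refl
  OnA⇒∈chainA (rise t≤)  = there (∈-corner-up 1 0 (suc a′) (up ∷ []) t≤)
  OnA⇒∈chainA (run t≤)   = there (∈-corner-right 1 0 (suc b′) (up ∷ []) t≤)
  OnA⇒∈chainA apex       = there (∈-corner-end 1 0 (suc b′) (suc a′) (up ∷ []) (there (here refl)))

  OnA⇒InBox : ∀ {v} → OnA v → InBox v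
  OnA⇒InBox origin    = z≤n , z≤n
  OnA⇒InBox (rise t≤) = s≤s z≤n , m≤n⇒m≤1+n t≤
  OnA⇒InBox (run t≤)  = s≤s t≤ , n≤1+n _
  OnA⇒InBox apex      = ≤-refl , ≤-refl

  OnA⇒hookIndex≤1 : ∀ {v} → OnA v → hookIndex v ≤ 1
  OnA⇒hookIndex≤1 origin          = z≤n
  OnA⇒hookIndex≤1 (rise {t} _)    = m⊓n≤m 1 (b ∸ t)
  OnA⇒hookIndex≤1 (run {t} _)     = ≤-trans (m⊓n≤n (suc t) _) (≤-reflexive (m+n∸n≡m 1 b′))
  OnA⇒hookIndex≤1 apex            = ≤-trans (m⊓n≤n a (b ∸ b)) (≤-trans (≤-reflexive (n∸n≡0 b′)) z≤n)

  OnA-bottom : ∀ {v} → OnA v → proj₂ v ≡ 0 → proj₁ v ≤ 1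
  OnA-bottom origin   _ = z≤n
  OnA-bottom (rise _) _ = ≤-refl

  OnA-top : ∀ {v} → OnA v → proj₂ v ≡ b → ¬ proj₁ v ≤ 1
  OnA-top (rise t≤) refl _ = 1+n≰n t≤
  OnA-top apex      refl (s≤s ())

  chainB : List Point
  chainB = corner (0 , 1) (suc b′) (suc a′) []

  data OnB : Point → Set where
    rise : ∀ {t} → t ≤ suc b′ → OnB (0 , suc t)
    run  : ∀ {t} → t ≤ suc a′ → OnB (t , b)

  chainB-points : ∀ {v} → v ∈ chainB → OnB v
  chainB-points v∈ with ∈-corner⁻ 0 1 (suc b′) (suc a′) [] v∈
  ... | inj₁ (t , t≤ , refl)        = rise t≤
  ... | inj₂ (inj₁ (t , t≤ , refl)) = run t≤
  ... | inj₂ (inj₂ (here refl))      = run ≤-refl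

  OnB⇒∈chainB : ∀ {v} → OnB v → v ∈ chainB
  OnB⇒∈chainB (rise t≤) = ∈-corner-up 0 1 (suc a′) [] t≤
  OnB⇒∈chainB (run t≤)  = ∈-corner-right 0 1 (suc b′) [] t≤

  OnB⇒InBox : ∀ {v} → OnB v → InBox v
  OnB⇒InBox (rise t≤) = z≤n , s≤s t≤
  OnB⇒InBox (run t≤)  = m≤n⇒m≤1+n t≤ , ≤-refl

  OnB⇒hookIndex≤1 : ∀ {v} → OnB v → hookIndex v ≤ 1
  OnB⇒hookIndex≤1 (rise _)    = z≤n
  OnB⇒hookIndex≤1 (run {t} _) = ≤-trans (m⊓n≤n t (b ∸ b)) (≤-trans (≤-reflexive (n∸n≡0 b′)) z≤n)

  OnB-bottom : ∀ {v} → OnB v → proj₂ v ≢ 0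
  OnB-bottom (rise _) ()
  OnB-bottom (run _)  ()

  OnA-OnB-disjoint : ∀ {v} → OnA v → OnB v → ⊥
  OnA-OnB-disjoint (rise t≤) (run _)  = 1+n≰n t≤
  OnA-OnB-disjoint (run _)   ()
  OnA-OnB-disjoint apex      (run t≤) = 1+n≰n t≤

  -- hook i is H_{2+i}
  hook : ℕ → List Point
  hook i = corner (2 + i , 0) (b′ ∸ i) (a′ ∸ i) []

  data OnHook (i : ℕ) : Point → Set where
    rise : ∀ {t} → t ≤ b′ ∸ i → OnHook i (2 + i , t)
    run  : ∀ {t} → t ≤ a′ ∸ i → OnHook i (2 + i + t , b′ ∸ i)

  hook-points : ∀ {i v} → v ∈ hook i → OnHook i v
  hook-points {i} v∈ with ∈-corner⁻ (2 + i) 0 (b′ ∸ i) (a′ ∸ i) [] v∈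
  ... | inj₁ (t , t≤ , refl)        = rise t≤
  ... | inj₂ (inj₁ (t , t≤ , refl)) = run t≤
  ... | inj₂ (inj₂ (here refl))      = run ≤-refl

  OnHook⇒∈hook : ∀ {i v} → OnHook i v → v ∈ hook i
  OnHook⇒∈hook {i} (rise t≤) = ∈-corner-up (2 + i) 0 (a′ ∸ i) [] t≤
  OnHook⇒∈hook {i} (run t≤)  = ∈-corner-right (2 + i) 0 (b′ ∸ i) [] t≤

  OnHook⇒InBox : ∀ {i v} → i ≤ a′ → OnHook i v → InBox v
  OnHook⇒InBox {i} i≤a′ (rise t≤) = s≤s (s≤s i≤a′) , ≤-trans t≤ (≤-trans (m∸n≤m b′ i) (m≤n+m b′ 2))
  OnHook⇒InBox {i} i≤a′ (run {t} t≤) =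
    s≤s (s≤s (subst (_≤ a′) (+-comm t i) (m≤o∸n⇒m+n≤o t i≤a′ t≤))) , ≤-trans (m∸n≤m b′ i) (m≤n+m b′ 2)

  OnHook⇒hookIndex : ∀ {i v} → i ≤ b′ → OnHook i v → hookIndex v ≡ 2 + i
  OnHook⇒hookIndex {i} i≤b′ (rise {t} t≤) = m≤n⇒m⊓n≡m
    (m+n≤o⇒m≤o∸n (2 + i) (s≤s (s≤s (subst (_≤ b′) (+-comm t i) (m≤o∸n⇒m+n≤o t i≤b′ t≤)))))
  OnHook⇒hookIndex {i} i≤b′ (run {t} _) = begin
    (2 + i + t) ⊓ (b ∸ (b′ ∸ i))   ≡⟨ cong ((2 + i + t) ⊓_) (+-∸-assoc 2 (m∸n≤m b′ i)) ⟩
    (2 + i + t) ⊓ (2 + (b′ ∸ (b′ ∸ i))) ≡⟨ cong (λ z → (2 + i + t) ⊓ (2 + z)) (m∸[m∸n]≡n i≤b′) ⟩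
    (2 + i + t) ⊓ (2 + i)          ≡⟨ m≥n⇒m⊓n≡n (m≤m+n (2 + i) t) ⟩
    2 + i                          ∎
    where open ≡-Reasoning

  OnHook-top : ∀ {i v} → OnHook i v → proj₂ v ≢ b
  OnHook-top {i} (rise t≤) t≡b = 1+n≰n (≤-trans (≤-reflexive (sym t≡b)) (m≤n⇒m≤1+n (≤-trans t≤ (m∸n≤m b′ i))))
  OnHook-top {i} (run _)   y≡b = 1+n≰n (≤-trans (≤-reflexive (sym y≡b)) (m≤n⇒m≤1+n (m∸n≤m b′ i)))

  interior-OnHook : ∀ {x y} → x ≤ a′ → y ≤ b′ → OnHook (x ⊓ (b′ ∸ y)) (2 + x , y)
  interior-OnHook {x} {y} x≤a′ y≤b′ with ≤-total x (b′ ∸ y)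
  ... | inj₁ x≤ = subst (λ i → OnHook i (2 + x , y)) (sym (m≤n⇒m⊓n≡m x≤)) (rise (∸-swap y≤b′ x≤))
  ... | inj₂ i≤x = subst (λ i → OnHook i (2 + x , y)) (sym (m≥n⇒m⊓n≡n i≤x))
        (subst (OnHook (b′ ∸ y)) (cong₂ _,_ (cong (2 +_) (m+[n∸m]≡n i≤x)) (m∸[m∸n]≡n y≤b′))
          (run (∸-monoˡ-≤ (b′ ∸ y) x≤a′)))

  chainA-good : GoodChain chainA
  chainA-good = path-symmetric (0 , 0) (right ∷ replicate (suc b′) up ++ replicate (suc a′) right ++ up ∷ []) total
              , All.tabulate (OnA⇒InBox ∘ chainA-points)
              , noColumnEndPair (_≤ 1) (OnA-bottom ∘ chainA-points) (OnA-top ∘ chainA-points)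
    where
    total : 0 + suc (length (replicate (suc b′) up ++ replicate (suc a′) right ++ up ∷ [])) + 0 ≡ a + b
    total = trans (+-identityʳ _) (trans (cong suc (length-corner (suc b′) (suc a′) (up ∷ []))) (shape a′ b′))
      where
      shape : ∀ p q → suc (suc q + (suc p + 1)) ≡ 2 + p + (2 + q)
      shape = solve-∀

  chainB-good : GoodChain chainB
  chainB-good = path-symmetric (0 , 1) (replicate (suc b′) up ++ replicate (suc a′) right ++ []) total
              , All.tabulate (OnB⇒InBox ∘ chainB-points)
              , noColumnEndPair (λ _ → ⊥) (OnB-bottom ∘ chainB-points) (λ _ _ ())
    where
    total : 1 + length (replicate (suc b′) up ++ replicate (suc a′) right ++ []) + 1 ≡ a + b
    total = trans (cong (λ l → 1 + l + 1) (length-corner (suc b′) (suc a′) [])) (shape a′ b′)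
      where
      shape : ∀ p q → 1 + (suc q + (suc p + 0)) + 1 ≡ 2 + p + (2 + q)
      shape = solve-∀

  hook-good : ∀ {i} → i ≤ a′ → i ≤ b′ → GoodChain (hook i)
  hook-good {i} i≤a′ i≤b′ =
                path-symmetric (2 + i , 0) (replicate (b′ ∸ i) up ++ replicate (a′ ∸ i) right ++ []) total
              , All.tabulate (OnHook⇒InBox i≤a′ ∘ hook-points)
              , noColumnEndPair (λ _ → ⊤) (λ _ _ → tt) (λ v∈ y≡b _ → OnHook-top (hook-points v∈) y≡b)
    where
    total : 2 + i + 0 + length (replicate (b′ ∸ i) up ++ replicate (a′ ∸ i) right ++ []) + (2 + i + 0) ≡ a + b
    total = begin
      2 + i + 0 + length (replicate (b′ ∸ i) up ++ replicate (a′ ∸ i) right ++ []) + (2 + i + 0)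
        ≡⟨ cong (λ l → 2 + i + 0 + l + (2 + i + 0)) (length-corner (b′ ∸ i) (a′ ∸ i) []) ⟩
      2 + i + 0 + (b′ ∸ i + (a′ ∸ i + 0)) + (2 + i + 0)
        ≡⟨ shape i (b′ ∸ i) (a′ ∸ i) ⟩
      2 + (i + (a′ ∸ i)) + (2 + (i + (b′ ∸ i)))
        ≡⟨ cong₂ (λ p q → 2 + p + (2 + q)) (m+[n∸m]≡n i≤a′) (m+[n∸m]≡n i≤b′) ⟩
      a + b ∎
      where
      open ≡-Reasoning
      shape : ∀ i p q → 2 + i + 0 + (p + (q + 0)) + (2 + i + 0) ≡ 2 + (i + q) + (2 + (i + p))
      shape = solve-∀

  hooks : List (List Point)
  hooks = applyUpTo hook (suc (a′ ⊓ b′))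

  decomposition : List (List Point)
  decomposition = chainA ∷ chainB ∷ hooks

  i<1+a′⊓b′⇒i≤a′ : ∀ {i} → i < suc (a′ ⊓ b′) → i ≤ a′
  i<1+a′⊓b′⇒i≤a′ i< = ≤-trans (s≤s⁻¹ i<) (m⊓n≤m a′ b′)

  i<1+a′⊓b′⇒i≤b′ : ∀ {i} → i < suc (a′ ⊓ b′) → i ≤ b′
  i<1+a′⊓b′⇒i≤b′ i< = ≤-trans (s≤s⁻¹ i<) (m⊓n≤n a′ b′)

  decomposition-good : All GoodChain decomposition
  decomposition-good = chainA-good ∷ chainB-good ∷ All.applyUpTo⁺₁ hook _ (λ i< →
    hook-good (i<1+a′⊓b′⇒i≤a′ i<) (i<1+a′⊓b′⇒i≤b′ i<))

  ∈hook⇒∈decomposition : ∀ {i v} → i ≤ a′ ⊓ b′ → v ∈ hook i → v ∈ concat decomposition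
  ∈hook⇒∈decomposition i≤ v∈ = ∈-++⁺ʳ chainA (∈-++⁺ʳ chainB (∈-concat⁺′ v∈ (∈-applyUpTo⁺ hook (s≤s i≤))))

  decomposition-covers : ∀ {v} → InBox v → v ∈ concat decomposition
  decomposition-covers {0 , 0}     _             = ∈-++⁺ˡ (OnA⇒∈chainA origin)
  decomposition-covers {0 , suc y} (_ , s≤s y≤)  = ∈-++⁺ʳ chainA (∈-++⁺ˡ (OnB⇒∈chainB (rise y≤)))
  decomposition-covers {suc x , y} (s≤s x≤ , y≤) with m≤n⇒m<n∨m≡n y≤ | m≤n⇒m<n∨m≡n x≤
  ... | inj₂ refl | inj₁ x<    = ∈-++⁺ʳ chainA (∈-++⁺ˡ (OnB⇒∈chainB (run x<)))
  ... | inj₂ refl | inj₂ refl  = ∈-++⁺ˡ (OnA⇒∈chainA apex)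
  ... | inj₁ (s≤s y≤′) | _     = below-top x x≤ y≤′
    where
    below-top : ∀ x → x ≤ suc a′ → y ≤ suc b′ → (suc x , y) ∈ concat decomposition
    below-top 0        _  y≤′ = ∈-++⁺ˡ (OnA⇒∈chainA (rise y≤′))
    below-top (suc x′) x≤ y≤′ with m≤n⇒m<n∨m≡n y≤′
    ... | inj₂ refl       = ∈-++⁺ˡ (OnA⇒∈chainA (run x≤))
    ... | inj₁ (s≤s y≤b′) = ∈hook⇒∈decomposition (⊓-mono-≤ (s≤s⁻¹ x≤) (m∸n≤m b′ y))
                              (OnHook⇒∈hook (interior-OnHook (s≤s⁻¹ x≤) y≤b′))


  A-B-disjoint : Disjoint chainA chainB
  A-B-disjoint (v∈A , v∈B) = OnA-OnB-disjoint (chainA-points v∈A) (chainB-points v∈B)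

  low-hook-disjoint : ∀ {L i} → (∀ {v} → v ∈ L → hookIndex v ≤ 1) → i ≤ b′ → Disjoint L (hook i)
  low-hook-disjoint low i≤b′ (v∈L , v∈hook) =
    1+n≰n (≤-trans (≤-reflexive (sym (OnHook⇒hookIndex i≤b′ (hook-points v∈hook))))
                   (≤-trans (low v∈L) (s≤s z≤n)))

  hook-hook-disjoint : ∀ {i j} → i < j → j ≤ b′ → Disjoint (hook i) (hook j)
  hook-hook-disjoint i<j j≤b′ (v∈i , v∈j) = <-irrefl
    (+-cancelˡ-≡ 2 _ _ (trans (sym (OnHook⇒hookIndex (≤-trans (<⇒≤ i<j) j≤b′) (hook-points v∈i)))
                              (OnHook⇒hookIndex j≤b′ (hook-points v∈j)))) i<j

  decomposition-unique : Unique (concat decomposition)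
  decomposition-unique = Unique.concat⁺
    (All.map (steps⇒unique ∘ proj₁ ∘ proj₁) decomposition-good)
    ( (A-B-disjoint ∷ All.applyUpTo⁺₁ hook _
        (λ i< → low-hook-disjoint (OnA⇒hookIndex≤1 ∘ chainA-points) (i<1+a′⊓b′⇒i≤b′ i<)))
    ∷ All.applyUpTo⁺₁ hook _ (λ i< → low-hook-disjoint (OnB⇒hookIndex≤1 ∘ chainB-points) (i<1+a′⊓b′⇒i≤b′ i<))
    ∷ AllPairs.applyUpTo⁺₁ hook _ (λ i<j j< → hook-hook-disjoint i<j (i<1+a′⊓b′⇒i≤b′ j<)))

-- Cuboids whose sides are chains skipping no ranks

last-index : ∀ {L} → Fin L → ∃[ m ] (toℕ {L} m ≡ pred L)
last-index {suc L} _ = fromℕ L , toℕ-fromℕ L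

module CuboidOfChains {s : ℕ} (n : Fin s → ℕ) (blk : Fin s → Fin 3) (C : Fin 3 → List (Elt n))
  (sides : ∀ j → IsChain n (block n blk j) (C j) × SkipsNoRanks n (block n blk j) (C j)) where

  open Cuboid n blk C

  I : Fin 3 → Idx s
  I = block n blk

  block-true : ∀ {i j} → blk i ≡ j → I j i ≡ true
  block-true {i} {j} bi≡j with blk i ≟ j
  ... | yes _    = refl
  ... | no bi≢j = ⊥-elim (bi≢j bi≡j)

  block-true⁻ : ∀ {i j} → I j i ≡ true → blk i ≡ j
  block-true⁻ {i} {j} Iji with blk i ≟ j
  ... | yes bi≡j = bi≡j

  sideElt : Fin 3 → Pos → Elt n
  sideElt j p = lookup (C j) (coord j p)

  side-lookup : ∀ j → ∃[ r ] (∀ k → rank n (I j) (lookup (C j) k) ≡ r + toℕ k)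
  side-lookup j =
    skipsNoValues-lookup (rank n (I j)) (Linked.map (rank-strictMono n (I j)) (proj₁ (sides j))) (proj₂ (sides j))

  sideBase : Fin 3 → ℕ
  sideBase j = proj₁ (side-lookup j)

  side-rank : ∀ j k → rank n (I j) (lookup (C j) k) ≡ sideBase j + toℕ k
  side-rank j = proj₂ (side-lookup j)

  rank-elt-split : ∀ p → rank n allIdx (elt p) ≡
    rank n (I 0F) (sideElt 0F p) + rank n (I 1F) (sideElt 1F p) + rank n (I 2F) (sideElt 2F p)
  rank-elt-split p = trans (Σℕ-cong s summand) (trans (Σℕ-+ s (λ i → g 0F i + g 1F i) (g 2F))
    (cong (_+ Σℕ s (g 2F)) (Σℕ-+ s (g 0F) (g 1F))))
    where
    g : Fin 3 → Fin s → ℕ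
    g j i = if I j i then ∣ sideElt j p i ∣ else 0
    summand : ∀ i → ∣ elt p i ∣ ≡ g 0F i + g 1F i + g 2F i
    summand i with blk i
    ... | 0F = sym (trans (+-identityʳ _) (+-identityʳ _))
    ... | 1F = sym (+-identityʳ _)
    ... | 2F = refl

  baseRank : ℕ
  baseRank = sideBase 0F + sideBase 1F + sideBase 2F

  rank-elt : ∀ p → rank n allIdx (elt p) ≡ baseRank + crank p
  rank-elt p = begin
    rank n allIdx (elt p)
      ≡⟨ rank-elt-split p ⟩
    rank n (I 0F) (sideElt 0F p) + rank n (I 1F) (sideElt 1F p) + rank n (I 2F) (sideElt 2F p)
      ≡⟨ cong₂ _+_ (cong₂ _+_ (side-rank 0F _) (side-rank 1F _)) (side-rank 2F _) ⟩
    sideBase 0F + toℕ (coord 0F p) + (sideBase 1F + toℕ (coord 1F p))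
      + (sideBase 2F + toℕ (coord 2F p))
      ≡⟨ regroup (sideBase 0F) (sideBase 1F) (sideBase 2F) _ _ _ ⟩
    baseRank + crank p ∎
    where
    open ≡-Reasoning
    regroup : ∀ a b c x y z → a + x + (b + y) + (c + z) ≡ a + b + c + (x + y + z)
    regroup = solve-∀

  lookup-injective : ∀ j {u v} → EqOn n (I j) (lookup (C j) u) (lookup (C j) v) → u ≡ v
  lookup-injective j {u} {v} u≈v = toℕ-injective (+-cancelˡ-≡ (sideBase j) _ _
    (trans (sym (side-rank j u)) (trans (rank-cong n (I j) u≈v) (side-rank j v))))

  lookup-min : ∀ j {u} → IsMin n (I j) (lookup (C j) u) → toℕ u ≡ 0
  lookup-min j {u} u-min = m+n≡0⇒n≡0 (sideBase j) (trans (sym (side-rank j u)) (rank-min n (I j) u-min))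

  lookup-max : ∀ j {u} → IsMax n (I j) (lookup (C j) u) → toℕ u ≡ pred (length (C j))
  lookup-max j {u} u-max with last-index u
  ... | m , m-last = ≤-antisym (toℕ≤pred[n] u) (+-cancelˡ-≤ (sideBase j) _ _ (begin
    sideBase j + pred (length (C j))   ≡⟨ cong (sideBase j +_) m-last ⟨
    sideBase j + toℕ m                 ≡⟨ side-rank j m ⟨
    rank n (I j) (lookup (C j) m)      ≤⟨ rank≤rankTop n (I j) (lookup (C j) m) ⟩
    rankTop n (I j)                    ≡⟨ rank-max n (I j) u-max ⟨
    rank n (I j) (lookup (C j) u)      ≡⟨ side-rank j u ⟩
    sideBase j + toℕ u                 ∎))
    where
    open ≤-Reasoning

  _⋖_ : Pos → Pos → Set
  p ⋖ q = ∃[ j ] (toℕ (coord j q) ≡ suc (toℕ (coord j p)) × (∀ j′ → j′ ≢ j → coord j′ q ≡ coord j′ p))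

  ⋖⇒≤c : ∀ {p q} → p ⋖ q → p ≤c q
  ⋖⇒≤c (j , q≡1+p , same) j′ with j′ ≟ j
  ... | yes refl  = ≤-trans (n≤1+n _) (≤-reflexive (sym q≡1+p))
  ... | no j′≢j   = ≤-reflexive (cong toℕ (sym (same j′ j′≢j)))

  ⋖-crank : ∀ {p q} → p ⋖ q → crank q ≡ suc (crank p)
  ⋖-crank (0F , q≡1+p , same)
    rewrite q≡1+p | same 1F (λ ()) | same 2F (λ ()) = refl
  ⋖-crank {p} (1F , q≡1+p , same)
    rewrite q≡1+p | same 0F (λ ()) | same 2F (λ ()) =
      cong (_+ toℕ (coord 2F p)) (+-suc (toℕ (coord 0F p)) _)
  ⋖-crank {p} (2F , q≡1+p , same)
    rewrite q≡1+p | same 0F (λ ()) | same 1F (λ ()) = +-suc (toℕ (coord 0F p) + toℕ (coord 1F p)) _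

  ⋖-rank : ∀ {p q} → p ⋖ q → UnitStep (rank n allIdx) (elt p) (elt q)
  ⋖-rank {p} {q} p⋖q = trans (rank-elt q) (trans (cong (baseRank +_) (⋖-crank p⋖q))
    (trans (+-suc baseRank (crank p)) (cong suc (sym (rank-elt p)))))

  ⋖⇒⊆ : ∀ {p q} → p ⋖ q → _≤[_]_ n (elt p) allIdx (elt q)
  ⋖⇒⊆ {p} {q} (j , q≡1+p , same) i _ with blk i ≟ j
  ... | yes refl = proj₁ (Linked-lookup-suc (proj₁ (sides j)) (coord j p) (coord j q) q≡1+p) i (block-true refl)
  ... | no bi≢j  = ⊆-reflexive (cong (λ c → lookup (C (blk i)) c i) (sym (same (blk i) bi≢j)))

  ⋖⇒< : ∀ {p q} → p ⋖ q → _<[_]_ n (elt p) allIdx (elt q)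
  ⋖⇒< p⋖q = ⋖⇒⊆ p⋖q , λ p≈q → 1+n≢n (trans (sym (⋖-rank p⋖q)) (sym (rank-cong n allIdx p≈q)))

  ⋖-linked⇒chain : ∀ {ps} → Linked _⋖_ ps →
                    IsChain n allIdx (map elt ps) × SkipsNoRanks n allIdx (map elt ps)
  ⋖-linked⇒chain l = Linked.map⁺ (Linked.map ⋖⇒< l)
                   , unitSteps⇒skipsNoValues (rank n allIdx) (Linked.map⁺ (Linked.map ⋖-rank l))

  goodPair-lift : ∀ j {p q} → GoodPair n (I j) (sideElt j p) (sideElt j q) → GoodPair n allIdx (elt p) (elt q)
  goodPair-lift j (i , Iji , ne , not-ends) with block-true⁻ Iji
  ... | refl = i , refl , ne , not-ends

-- Cuboids with a one-element side

clamp : (m : ℕ) → ℕ → Fin (suc m)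
clamp m x = fromℕ< (s≤s (m⊓n≤n x m))

toℕ-clamp : ∀ {m x} → x ≤ m → toℕ (clamp m x) ≡ x
toℕ-clamp {m} {x} x≤m = trans (toℕ-fromℕ< (s≤s (m⊓n≤n x m))) (m≤n⇒m⊓n≡m x≤m)

module FlatCuboid {s : ℕ} (n : Fin s → ℕ) (blk : Fin s → Fin 3) (C : Fin 3 → List (Elt n))
  (sides : ∀ j → IsChain n (block n blk j) (C j) × SkipsNoRanks n (block n blk j) (C j))
  (a′ b′ : ℕ) (len₀ : length (C 0F) ≡ 1)
  (len₁ : length (C 1F) ≡ 3 + a′) (len₂ : length (C 2F) ≡ 3 + b′)
  (vp₁ : VeryProper n (block n blk 1F) (C 1F))
  (pr₂ : Proper n (block n blk 2F) (C 2F)) where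

  open Cuboid n blk C
  open CuboidOfChains n blk C sides
  open Box a′ b′

  toPos : Point → Pos
  toPos (x , y) = cast (sym len₀) 0F , cast (sym len₁) (clamp a x) , cast (sym len₂) (clamp b y)

  fromPos : Pos → Point
  fromPos p = toℕ (coord 1F p) , toℕ (coord 2F p)

  toℕ-toPos₀ : ∀ u → toℕ (coord 0F (toPos u)) ≡ 0
  toℕ-toPos₀ u = toℕ-cast (sym len₀) 0F

  toℕ-toPos₁ : ∀ {u} → InBox u → toℕ (coord 1F (toPos u)) ≡ proj₁ u
  toℕ-toPos₁ (x≤a , _) = trans (toℕ-cast (sym len₁) _) (toℕ-clamp x≤a)

  toℕ-toPos₂ : ∀ {u} → InBox u → toℕ (coord 2F (toPos u)) ≡ proj₂ u
  toℕ-toPos₂ (_ , y≤b) = trans (toℕ-cast (sym len₂) _) (toℕ-clamp y≤b)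

  fromPos-InBox : ∀ p → InBox (fromPos p)
  fromPos-InBox p = ≤-trans (toℕ≤pred[n] (coord 1F p)) (≤-reflexive (cong pred len₁))
                  , ≤-trans (toℕ≤pred[n] (coord 2F p)) (≤-reflexive (cong pred len₂))

  toPos-fromPos : ∀ p → toPos (fromPos p) ≡ p
  toPos-fromPos p@(p₀ , p₁ , p₂) = cong₂ _,_ (toℕ-injective (trans (toℕ-toPos₀ (fromPos p)) (sym p₀≡0)))
    (cong₂ _,_ (toℕ-injective (toℕ-toPos₁ (fromPos-InBox p))) (toℕ-injective (toℕ-toPos₂ (fromPos-InBox p))))
    where
    p₀≡0 : toℕ p₀ ≡ 0
    p₀≡0 = n≤0⇒n≡0 (≤-trans (toℕ≤pred[n] p₀) (≤-reflexive (cong pred len₀)))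

  fromPos-toPos : ∀ {u} → InBox u → fromPos (toPos u) ≡ u
  fromPos-toPos u∈ = cong₂ _,_ (toℕ-toPos₁ u∈) (toℕ-toPos₂ u∈)

  toPos-crank : ∀ {u} → InBox u → crank (toPos u) ≡ rk u
  toPos-crank {u} u∈ = cong₂ _+_ (cong₂ _+_ (toℕ-toPos₀ u) (toℕ-toPos₁ u∈)) (toℕ-toPos₂ u∈)

  toPos-⋖ : ∀ {u v} → InBox u → InBox v → Step u v → toPos u ⋖ toPos v
  toPos-⋖ u∈ v∈ (up , refl) = 2F , trans (toℕ-toPos₂ v∈) (cong suc (sym (toℕ-toPos₂ u∈))) , λ where
    0F _  → refl
    1F _  → refl
    2F ne → ⊥-elim (ne refl)
  toPos-⋖ u∈ v∈ (right , refl) = 1F , trans (toℕ-toPos₁ v∈) (cong suc (sym (toℕ-toPos₁ u∈))) , λ where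
    0F _  → refl
    1F ne → ⊥-elim (ne refl)
    2F _  → refl

  toPos-linked : ∀ {L} → All InBox L → Linked Step L → Linked (_⋖_ on toPos) L
  toPos-linked _                  []           = []
  toPos-linked _                  [-]          = [-]
  toPos-linked (u∈ ∷ v∈ ∷ inBox) (u→v ∷ l) = toPos-⋖ u∈ v∈ u→v ∷ toPos-linked (v∈ ∷ inBox) l

  Ntop≡a+b : Ntop ≡ a + b
  Ntop≡a+b = cong₂ _+_ (cong₂ _+_ (cong (_∸ 1) len₀) (cong (_∸ 1) len₁)) (cong (_∸ 1) len₂)

  x-determined : ∀ {u v} → InBox u → InBox v →
    EqOn n (I 1F) (sideElt 1F (toPos u)) (sideElt 1F (toPos v)) → proj₁ u ≡ proj₁ v
  x-determined u∈ v∈ u≈v =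
    trans (sym (toℕ-toPos₁ u∈)) (trans (cong toℕ (lookup-injective 1F u≈v)) (toℕ-toPos₁ v∈))

  y-determined : ∀ {u v} → InBox u → InBox v →
    EqOn n (I 2F) (sideElt 2F (toPos u)) (sideElt 2F (toPos v)) → proj₂ u ≡ proj₂ v
  y-determined u∈ v∈ u≈v =
    trans (sym (toℕ-toPos₂ u∈)) (trans (cong toℕ (lookup-injective 2F u≈v)) (toℕ-toPos₂ v∈))

  min⇒bottom : ∀ {u} → InBox u → IsMin n (I 2F) (sideElt 2F (toPos u)) → proj₂ u ≡ 0
  min⇒bottom u∈ u-min = trans (sym (toℕ-toPos₂ u∈)) (lookup-min 2F u-min)

  max⇒top : ∀ {u} → InBox u → IsMax n (I 2F) (sideElt 2F (toPos u)) → proj₂ u ≡ b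
  max⇒top u∈ u-max = trans (sym (toℕ-toPos₂ u∈)) (trans (lookup-max 2F u-max) (cong pred len₂))

  toPos-goodPair : ∀ {u v} → InBox u → InBox v →
    (proj₂ u ≡ 0 → proj₂ v ≡ b → proj₁ u ≢ proj₁ v) → (proj₂ v ≡ 0 → proj₂ u ≡ b → proj₁ v ≢ proj₁ u) →
    ¬ EqOn n allIdx (elt (toPos u)) (elt (toPos v)) → GoodPair n allIdx (elt (toPos u)) (elt (toPos v))
  toPos-goodPair {u} {v} u∈ v∈ u-v-ends v-u-ends u≉v with proj₁ u ≟ℕ proj₁ v | proj₂ u ≟ℕ proj₂ v
  ... | no xu≢xv  | _         = goodPair-lift 1F
    (proj₂ (proj₂ vp₁) (∈-lookup _) (∈-lookup _) (xu≢xv ∘ x-determined u∈ v∈))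
  ... | yes xu≡xv | yes yu≡yv = ⊥-elim (u≉v (λ i _ → cong (λ w → elt (toPos w) i) (cong₂ _,_ xu≡xv yu≡yv)))
  ... | yes xu≡xv | no yu≢yv  = goodPair-lift 2F
    (proj₂ (proj₂ pr₂) (∈-lookup _) (∈-lookup _) (yu≢yv ∘ y-determined u∈ v∈) λ where
      (inj₁ (u-min , v-max)) → u-v-ends (min⇒bottom u∈ u-min) (max⇒top v∈ v-max) xu≡xv
      (inj₂ (u-max , v-min)) → v-u-ends (min⇒bottom v∈ v-min) (max⇒top u∈ u-max) (sym xu≡xv))

  goodChain⇒symmetric∧veryProper : ∀ {L} → GoodChain L →
    SymmetricChain (map toPos L) × VeryProper n allIdx (map elt (map toPos L))
  goodChain⇒symmetric∧veryProper {L} ((steps , j , 2j≤ , ranks) , inBox , no-ends) =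
    (Linked.map ⋖⇒≤c positions , j , subst (2 * j ≤_) (sym Ntop≡a+b) 2j≤ , cranks) ,
    proj₁ chain , proj₂ chain , pairs
    where
    positions : Linked _⋖_ (map toPos L)
    positions = Linked.map⁺ (toPos-linked inBox steps)

    cranks : map crank (map toPos L) ≡ applyUpTo (j +_) (suc (Ntop ∸ j ∸ j))
    cranks = begin
      map crank (map toPos L)             ≡⟨ map-∘ L ⟨
      map (crank ∘ toPos) L               ≡⟨ map-cong-local (All.map toPos-crank inBox) ⟩
      map rk L                            ≡⟨ ranks ⟩
      applyUpTo (j +_) (suc (a + b ∸ j ∸ j)) ≡⟨ cong (λ N → applyUpTo (j +_) (suc (N ∸ j ∸ j))) Ntop≡a+b ⟨
      applyUpTo (j +_) (suc (Ntop ∸ j ∸ j)) ∎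
      where open ≡-Reasoning

    chain : IsChain n allIdx (map elt (map toPos L)) × SkipsNoRanks n allIdx (map elt (map toPos L))
    chain = ⋖-linked⇒chain positions

    pairs : ∀ {x x′} → x ∈ map elt (map toPos L) → x′ ∈ map elt (map toPos L) →
            ¬ EqOn n allIdx x x′ → GoodPair n allIdx x x′
    pairs x∈ x′∈ with ∈-map⁻ elt x∈ | ∈-map⁻ elt x′∈
    ... | p , p∈ , refl | p′ , p′∈ , refl with ∈-map⁻ toPos p∈ | ∈-map⁻ toPos p′∈
    ...   | u , u∈L , refl | v , v∈L , refl =
      toPos-goodPair (All.lookup inBox u∈L) (All.lookup inBox v∈L) (no-ends u∈L v∈L) (no-ends v∈L u∈L)

  map-fromPos-toPos : ∀ {L} → All InBox L → map fromPos (map toPos L) ≡ L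
  map-fromPos-toPos []           = refl
  map-fromPos-toPos (u∈ ∷ inBox) = cong₂ _∷_ (fromPos-toPos u∈) (map-fromPos-toPos inBox)

  hasVeryProperDecomposition : HasVeryProperDecomposition
  hasVeryProperDecomposition = map (map toPos) decomposition , covers , unique ,
    All.map⁺ (All.map goodChain⇒symmetric∧veryProper decomposition-good)
    where
    inBox : All InBox (concat decomposition)
    inBox = All.concat⁺ (All.map (proj₁ ∘ proj₂) decomposition-good)

    covers : ∀ p → p ∈ concat (map (map toPos) decomposition)
    covers p = subst₂ _∈_ (toPos-fromPos p) (sym (concat-map decomposition))
      (∈-map⁺ toPos (decomposition-covers (fromPos-InBox p)))

    unique : Unique (concat (map (map toPos) decomposition))
    unique = subst Unique (sym (concat-map decomposition))
      (Unique.map⁻ (subst Unique (sym (map-fromPos-toPos inBox)) decomposition-unique))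

lemma6p7 : (s : ℕ) (n : Fin s → ℕ) → (∀ i → 2 ≤ n i) →
    (blk : Fin s → Fin 3) → (∀ j → ∃[ i ] (blk i ≡ j)) →
    (C : Fin 3 → List (Elt n)) →
    (∀ j → IsChain n (block n blk j) (C j) × SkipsNoRanks n (block n blk j) (C j)) →
    (r₂ r₃ : ℕ) →
    length (C 0F) ≡ 1 → length (C (sF 0F)) ≡ r₂ → length (C (sF (sF 0F))) ≡ r₃ →
    3 ≤ r₂ → 3 ≤ r₃ →
    (∀ j → Proper n (block n blk j) (C j)) →
    (∀ j → length (C j) < 5 → VeryProper n (block n blk j) (C j)) →
    VeryProper n (block n blk (sF 0F)) (C (sF 0F)) →
    Cuboid.HasVeryProperDecomposition n blk C
lemma6p7 s n _ blk _ C sides _ _ len₀ len₁ len₂ (s≤s (s≤s (s≤s {n = a′} _))) (s≤s (s≤s (s≤s {n = b′} _)))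
         proper _ vp₁ =
  FlatCuboid.hasVeryProperDecomposition n blk C sides a′ b′ len₀ len₁ len₂ vp₁ (proper 2F)
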